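{- Let $s$, $t$, and $n$ be positive integers. Let $S_1$ be the set of lattice paths from $(0,0)$ to $(sn+1,tn)$ that avoid $A_{s,t}$, and let $S_2$ be the set of lattice paths from $(1,0)$ to $(sn,tn-1)$ that avoid $A_{s,t}$. Then \[ |S_1| = t \binom{sn+tn}{tn} - s \binom{sn+tn }{tn-1} \quad\text{and}\quad |S_2| = t \binom{sn+tn-2 }{tn-1} - s \binom{sn+tn-2 }{tn-2}. \]
   Context: A lattice path is a finite path in the plane whose steps are each either north $(0,1)$ or east $(1,0)$. For positive integers $s,t$, $A_{s,t}$ is the infinite staircase path that starts at $(0,t)$ and then takes $s$ steps east, $t$ steps north, $s$ steps east, $t$ steps north, and so on forever. A lattice path avoids $A_{s,t}$ if it never touches or crosses $A_{s,t}$, i.e. it has no lattice point in common with $A_{s,t}$. Binomial coefficients $\binom{m}{i}$ with $i<0$ are $0$. -}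

module Defs where

open import Data.Nat using (ℕ; zero; suc; _+_; _*_; _≤_)
open import Data.Nat.Combinatorics using (_C_)
open import Data.Integer as ℤ using (ℤ; +_; -[1+_])
open import Data.Product using (_×_; _,_; ∃)
open import Data.Sum using (_⊎_)
open import Data.List using (List; []; _∷_)
open import Data.List.Relation.Unary.All using (All)
open import Relation.Binary.PropositionalEquality using (_≡_)
open import Relation.Nullary using (¬_)

data Step : Set where
  N E : Step

Point : Set
Point = ℕ × ℕ

move : Point → Step → Point
move (x , y) N = (x , suc y)
move (x , y) E = (suc x , y)

points : Point → List Step → List Point
points p []       = p ∷ []
points p (d ∷ ds) = p ∷ points (move p d) ds

endpoint : Point → List Step → Point
endpoint p []       = p
endpoint p (d ∷ ds) = endpoint (move p d) ds

-- The lattice points of the staircase A_{s,t}: starting at (0,t), the k-th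
-- (k ≥ 0) east run consists of the points (x,(k+1)t) with ks ≤ x ≤ (k+1)s,
-- and the k-th north run of the points ((k+1)s, y) with (k+1)t ≤ y ≤ (k+2)t.
OnA : ℕ → ℕ → Point → Set
OnA s t (x , y) = ∃ λ k →
    (k * s ≤ x × x ≤ suc k * s × y ≡ suc k * t)
  ⊎ (x ≡ suc k * s × suc k * t ≤ y × y ≤ suc (suc k) * t)

AvoidingPath : ℕ → ℕ → Point → Point → List Step → Set
AvoidingPath s t p q ds = endpoint p ds ≡ q × All (λ r → ¬ OnA s t r) (points p ds)

binom : ℕ → ℤ → ℤ
binom m (+ i)    = + (m C i)
binom m -[1+ _ ] = + 0

-- Cut a lattice path after every t-th north step.  It avoids the staircase A_{s,t} exactly when, for each
-- k, its first k blocks contain more than k s east steps (for the paths from (1,0), which stop just below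
-- the last corner, at least k s of them for k < n).  In terms of the excesses e_i − s of the blocks these
-- are conditions on the partial sums of a cyclic sequence of total 1 (resp. −1), and by the cycle lemma
-- exactly one of its n rotations satisfies them.  Counting pairs (word, rotation) therefore gives
-- n |S| = C(a + t n − 1, t n − 1) for the words with the right numbers of steps, and the absorption
-- identity (b + 1) C(m, b + 1) = (m − b) C(m, b) rewrites this as the stated differences.

module Submission where

open import Data.Bool using (true; false; if_then_else_)
open import Data.Empty using (⊥)
open import Data.Integer using (ℤ; +_; _-_; 0ℤ; 1ℤ; -1ℤ) renaming (_*_ to _*ℤ_)
import Data.Integer as ℤ
import Data.Integer.Properties as ℤ
import Data.Integer.Tactic.RingSolver as ℤ
open import Data.List using (List; []; _∷_; _++_; _∷ʳ_; length; map; take; drop; concat; filter; initLast; _∷ʳ′_)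
open import Data.List.Membership.Propositional using (_∈_)
open import Data.List.Membership.Propositional.Properties
  using (∈-map⁺; ∈-map⁻; ∈-++⁺ˡ; ∈-++⁺ʳ; ∈-++⁻; ∈-filter⁺; ∈-filter⁻)
open import Data.List.Membership.Propositional.Properties.WithK using (unique∧set⇒bag)
open import Data.List.Properties
  using (length-++; length-map; length-drop; take++drop≡id; take-take; take-[]; map-++; take-map; drop-map;
         ++-assoc; ++-identityʳ; ∷-injectiveʳ; ∷ʳ-injectiveˡ; concat-++)
open import Data.List.Relation.Binary.BagAndSetEquality using (∼bag⇒↭)
open import Data.List.Relation.Binary.Permutation.Propositional.Properties using (↭-length)
open import Data.List.Relation.Unary.All as All using (All; []; _∷_)
import Data.List.Relation.Unary.All.Properties as All
open import Data.List.Relation.Unary.AllPairs using ([]; _∷_)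
open import Data.List.Relation.Unary.Any using (here; there)
open import Data.List.Relation.Unary.Unique.Propositional using (Unique)
import Data.List.Relation.Unary.Unique.Propositional.Properties as Unique
open import Data.Nat using (ℕ; zero; suc; _+_; _*_; _∸_; _≤_; _<_; z≤n; s≤s; pred; _≤?_; _<?_; NonZero)
open import Data.Nat.Combinatorics using (_C_; nCn≡1; nC1≡n; nCk≡nC[n∸k]; nCk+nC[k+1]≡[n+1]C[k+1])
open import Data.Nat.ListAction using (sum)
open import Data.Nat.ListAction.Properties using (sum-++)
open import Data.Nat.Properties
open import Data.Nat.Tactic.RingSolver using (solve-∀)
open import Data.Product using (_×_; _,_; ∃; ∃!; proj₁; proj₂; map₁; map₂)
open import Data.Sum using (_⊎_; inj₁; inj₂)
open import Data.Unit using (⊤; tt)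
open import Function using (_∘_; id; _⇔_; mk⇔; Equivalence)
open import Relation.Binary.Definitions using (tri<; tri≈; tri>)
open import Relation.Binary.PropositionalEquality
open import Relation.Nullary using (¬_; Dec; does; yes; no; contradiction; _×-dec_)
open import Relation.Nullary.Decidable using (dec-true; dec-false)
open import Relation.Unary using (Decidable)

open import Defs

open ≡-Reasoning

private
  variable
    A A′ : Set

All-++-⇔ : ∀ {P : A → Set} {Q R : Set} xs {ys} →
  (All P xs ⇔ Q) → (Q → All P ys ⇔ R) → All P (xs ++ ys) ⇔ (Q × R)
All-++-⇔ xs first rest = mk⇔
  (λ all → let (all₁ , all₂) = All.++⁻ xs all
               q = Equivalence.to first all₁
           in q , Equivalence.to (rest q) all₂)
  (λ (q , r) → All.++⁺ (Equivalence.from first q) (Equivalence.from (rest q) r))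

length-≡-from-members : ∀ {xs ys : List A} → Unique xs → Unique ys → (∀ {z} → z ∈ xs ⇔ z ∈ ys) →
  length xs ≡ length ys
length-≡-from-members xs! ys! same = ↭-length (∼bag⇒↭ (unique∧set⇒bag xs! ys! same))

map-Unique-injectiveOn : ∀ (f : A → A′) {xs} → (∀ {x y} → x ∈ xs → y ∈ xs → f x ≡ f y → x ≡ y) →
  Unique xs → Unique (map f xs)
map-Unique-injectiveOn f          injective []          = []
map-Unique-injectiveOn f {x ∷ xs} injective (x∉ ∷ xs!) =
  distinct x∉ there ∷ map-Unique-injectiveOn f (λ x∈ y∈ → injective (there x∈) (there y∈)) xs!
  where
  distinct : ∀ {ys} → All (x ≢_) ys → (∀ {y} → y ∈ ys → y ∈ x ∷ xs) → All (f x ≢_) (map f ys)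
  distinct []           _   = []
  distinct (x≢y ∷ x≢ys) sub = (x≢y ∘ injective (here refl) (sub (here refl))) ∷ distinct x≢ys (sub ∘ there)

length-≡-from-inverses : ∀ {xs : List A} {ys : List A′} (f : A → A′) (g : A′ → A) → Unique xs → Unique ys →
  (∀ {x} → x ∈ xs → f x ∈ ys) → (∀ {y} → y ∈ ys → g y ∈ xs) →
  (∀ {x} → x ∈ xs → g (f x) ≡ x) → (∀ {y} → y ∈ ys → f (g y) ≡ y) →
  length xs ≡ length ys
length-≡-from-inverses {xs = xs} {ys} f g xs! ys! f∈ g∈ g∘f f∘g =
  trans (sym (length-map f xs)) (length-≡-from-members (map-Unique-injectiveOn f injective xs!) ys! (mk⇔ to from))
  where
  injective : ∀ {x y} → x ∈ xs → y ∈ xs → f x ≡ f y → x ≡ y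
  injective x∈ y∈ fx≡fy = trans (sym (g∘f x∈)) (trans (cong g fx≡fy) (g∘f y∈))
  to : ∀ {z} → z ∈ map f xs → z ∈ ys
  to z∈ with ∈-map⁻ f z∈
  ... | x , x∈ , refl = f∈ x∈
  from : ∀ {z} → z ∈ ys → z ∈ map f xs
  from z∈ = subst (_∈ map f xs) (f∘g z∈) (∈-map⁺ f (g∈ z∈))

take-length-++ : ∀ (xs ys : List A) → take (length xs) (xs ++ ys) ≡ xs
take-length-++ []       ys = refl
take-length-++ (x ∷ xs) ys = cong (x ∷_) (take-length-++ xs ys)

drop-length-++ : ∀ (xs ys : List A) → drop (length xs) (xs ++ ys) ≡ ys
drop-length-++ []       ys = refl
drop-length-++ (x ∷ xs) ys = drop-length-++ xs ys

take-++ˡ : ∀ m (xs ys : List A) → m ≤ length xs → take m (xs ++ ys) ≡ take m xs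
take-++ˡ zero    xs       ys _         = refl
take-++ˡ (suc m) (x ∷ xs) ys (s≤s m≤n) = cong (x ∷_) (take-++ˡ m xs ys m≤n)

take-length+-++ : ∀ m (xs ys : List A) → take (length xs + m) (xs ++ ys) ≡ xs ++ take m ys
take-length+-++ m []       ys = refl
take-length+-++ m (x ∷ xs) ys = cong (x ∷_) (take-length+-++ m xs ys)

concat-∷ʳ : ∀ xss (ys : List A) → concat (xss ∷ʳ ys) ≡ concat xss ++ ys
concat-∷ʳ xss ys = trans (sym (concat-++ xss (ys ∷ []))) (cong (concat xss ++_) (++-identityʳ ys))

dropLast : List A → List A
dropLast []           = []
dropLast (x ∷ [])     = []
dropLast (x ∷ y ∷ xs) = x ∷ dropLast (y ∷ xs)

dropLast-∷ʳ : ∀ (xs : List A) x → dropLast (xs ∷ʳ x) ≡ xs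
dropLast-∷ʳ []           x = refl
dropLast-∷ʳ (y ∷ [])     x = refl
dropLast-∷ʳ (y ∷ z ∷ xs) x = cong (y ∷_) (dropLast-∷ʳ (z ∷ xs) x)

length-dropLast : ∀ (xs : List A) → length (dropLast xs) ≡ pred (length xs)
length-dropLast []           = refl
length-dropLast (x ∷ [])     = refl
length-dropLast (x ∷ y ∷ xs) = cong suc (length-dropLast (y ∷ xs))

take-dropLast : ∀ m (xs : List A) → m < length xs → take m (dropLast xs) ≡ take m xs
take-dropLast zero    xs           _         = refl
take-dropLast (suc m) (x ∷ [])     (s≤s ())
take-dropLast (suc m) (x ∷ y ∷ xs) (s≤s m<n) = cong (x ∷_) (take-dropLast m (y ∷ xs) m<n)

-- Rotations and prefix sums

rotate : ℕ → List A → List A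
rotate j xs = drop j xs ++ take j xs

length-rotate : ∀ j (xs : List A) → length (rotate j xs) ≡ length xs
length-rotate j xs = begin
  length (drop j xs ++ take j xs)           ≡⟨ length-++ (drop j xs) ⟩
  length (drop j xs) + length (take j xs)   ≡⟨ +-comm (length (drop j xs)) _ ⟩
  length (take j xs) + length (drop j xs)   ≡⟨ length-++ (take j xs) ⟨
  length (take j xs ++ drop j xs)           ≡⟨ cong length (take++drop≡id j xs) ⟩
  length xs                                 ∎

rotate-inverse : ∀ j (xs : List A) → rotate (length xs ∸ j) (rotate j xs) ≡ xs
rotate-inverse j xs = begin
  rotate (length xs ∸ j) (drop j xs ++ take j xs)
    ≡⟨ cong (λ k → rotate k (drop j xs ++ take j xs)) (length-drop j xs) ⟨
  rotate (length (drop j xs)) (drop j xs ++ take j xs)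
    ≡⟨ cong₂ _++_ (drop-length-++ (drop j xs) _) (take-length-++ (drop j xs) _) ⟩
  take j xs ++ drop j xs
    ≡⟨ take++drop≡id j xs ⟩
  xs ∎

map-rotate : ∀ (f : A → A′) j xs → map f (rotate j xs) ≡ rotate j (map f xs)
map-rotate f j xs = trans (map-++ f (drop j xs) (take j xs)) (sym (cong₂ _++_ (drop-map j xs) (take-map j xs)))

All-rotate : ∀ {P : A → Set} j {xs} → All P xs → All P (rotate j xs)
All-rotate j Pxs = All.++⁺ (All.drop⁺ j Pxs) (All.take⁺ j Pxs)

sum-rotate : ∀ j xs → sum (rotate j xs) ≡ sum xs
sum-rotate j xs = begin
  sum (drop j xs ++ take j xs)        ≡⟨ sum-++ (drop j xs) (take j xs) ⟩
  sum (drop j xs) + sum (take j xs)   ≡⟨ +-comm (sum (drop j xs)) _ ⟩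
  sum (take j xs) + sum (drop j xs)   ≡⟨ sum-++ (take j xs) (drop j xs) ⟨
  sum (take j xs ++ drop j xs)        ≡⟨ cong sum (take++drop≡id j xs) ⟩
  sum xs                              ∎

prefixSum : ℕ → List ℕ → ℕ
prefixSum m xs = sum (take m xs)

prefixSum-+ : ∀ j m xs → prefixSum (j + m) xs ≡ prefixSum j xs + prefixSum m (drop j xs)
prefixSum-+ zero    m xs       = refl
prefixSum-+ (suc j) m []       = sym (cong sum (take-[] m))
prefixSum-+ (suc j) m (x ∷ xs) = trans (cong (_+_ x) (prefixSum-+ j m xs)) (sym (+-assoc x _ _))

prefixSum-rotate-inner : ∀ j m xs → j + m ≤ length xs →
  prefixSum j xs + prefixSum m (rotate j xs) ≡ prefixSum (j + m) xs
prefixSum-rotate-inner j m xs j+m≤n = begin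
  prefixSum j xs + sum (take m (drop j xs ++ take j xs))
    ≡⟨ cong (λ ys → prefixSum j xs + sum ys) (take-++ˡ m (drop j xs) (take j xs) m≤n-j) ⟩
  prefixSum j xs + prefixSum m (drop j xs)
    ≡⟨ prefixSum-+ j m xs ⟨
  prefixSum (j + m) xs ∎
  where
  m≤n-j : m ≤ length (drop j xs)
  m≤n-j = subst (m ≤_) (sym (length-drop j xs)) (m+n≤o⇒m≤o∸n m (subst (_≤ length xs) (+-comm j m) j+m≤n))

prefixSum-rotate-wrap : ∀ {i j} xs → i ≤ j →
  prefixSum j xs + prefixSum (length xs ∸ j + i) (rotate j xs) ≡ sum xs + prefixSum i xs
prefixSum-rotate-wrap {i} {j} xs i≤j = begin
  prefixSum j xs + sum (take (length xs ∸ j + i) (drop j xs ++ take j xs))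
    ≡⟨ cong (λ k → prefixSum j xs + sum (take (k + i) (drop j xs ++ take j xs))) (length-drop j xs) ⟨
  prefixSum j xs + sum (take (length (drop j xs) + i) (drop j xs ++ take j xs))
    ≡⟨ cong (λ ys → prefixSum j xs + sum ys) (take-length+-++ i (drop j xs) (take j xs)) ⟩
  prefixSum j xs + sum (drop j xs ++ take i (take j xs))
    ≡⟨ cong (λ ys → prefixSum j xs + sum (drop j xs ++ ys))
            (trans (take-take i j xs) (cong (λ k → take k xs) (m≤n⇒m⊓n≡m i≤j))) ⟩
  prefixSum j xs + sum (drop j xs ++ take i xs)
    ≡⟨ cong (_+_ (prefixSum j xs)) (sum-++ (drop j xs) (take i xs)) ⟩
  prefixSum j xs + (sum (drop j xs) + prefixSum i xs)
    ≡⟨ +-assoc (prefixSum j xs) _ _ ⟨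
  sum (take j xs) + sum (drop j xs) + prefixSum i xs
    ≡⟨ cong (_+ prefixSum i xs) (trans (cong sum (sym (take++drop≡id j xs))) (sum-++ (take j xs) (drop j xs))) ⟨
  sum xs + prefixSum i xs ∎

-- Counting orbits

∑< : ℕ → (ℕ → ℕ) → ℕ
∑< zero    f = 0
∑< (suc n) f = ∑< n f + f n

∑<-cong : ∀ n {f g : ℕ → ℕ} → (∀ {j} → j < n → f j ≡ g j) → ∑< n f ≡ ∑< n g
∑<-cong zero    f≗g = refl
∑<-cong (suc n) f≗g = cong₂ _+_ (∑<-cong n (f≗g ∘ m<n⇒m<1+n)) (f≗g ≤-refl)

∑<-const : ∀ n c → ∑< n (λ _ → c) ≡ n * c
∑<-const zero    c = refl
∑<-const (suc n) c = trans (cong (_+ c) (∑<-const n c)) (+-comm (n * c) c)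

∑<-zero : ∀ n {f : ℕ → ℕ} → (∀ {j} → j < n → f j ≡ 0) → ∑< n f ≡ 0
∑<-zero n f≗0 = trans (∑<-cong n f≗0) (trans (∑<-const n 0) (*-zeroʳ n))

∑<-distrib-+ : ∀ n (f g : ℕ → ℕ) → ∑< n (λ j → f j + g j) ≡ ∑< n f + ∑< n g
∑<-distrib-+ zero    f g = refl
∑<-distrib-+ (suc n) f g =
  trans (cong (_+ (f n + g n)) (∑<-distrib-+ n f g)) (interchange (∑< n f) (∑< n g) (f n) (g n))
  where
  interchange : ∀ a b c d → a + b + (c + d) ≡ a + c + (b + d)
  interchange = solve-∀

indicator : ∀ {Q : Set} → Dec Q → ℕ
indicator Q? = if does Q? then 1 else 0

length-filter-∷ : ∀ {P : A → Set} (P? : Decidable P) x xs →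
  length (filter P? (x ∷ xs)) ≡ indicator (P? x) + length (filter P? xs)
length-filter-∷ P? x xs with does (P? x)
... | true  = refl
... | false = refl

∑<-indicator-unique : ∀ n {Q : ℕ → Set} (Q? : Decidable Q) → ∃! _≡_ (λ j → j < n × Q j) →
  ∑< n (indicator ∘ Q?) ≡ 1
∑<-indicator-unique (suc n) Q? (j , (j<1+n , Qj) , unique) with m<1+n⇒m<n∨m≡n j<1+n
... | inj₂ refl = cong₂ _+_ (∑<-zero n absent) (cong (λ b → if b then 1 else 0) (dec-true (Q? j) Qj))
  where
  absent : ∀ {k} → k < n → indicator (Q? k) ≡ 0
  absent k<n = cong (λ b → if b then 1 else 0)
    (dec-false (Q? _) (λ Qk → <-irrefl (sym (unique (m<n⇒m<1+n k<n , Qk))) k<n))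
... | inj₁ j<n = cong₂ _+_
  (∑<-indicator-unique n Q? (j , (j<n , Qj) , λ (k<n , Qk) → unique (m<n⇒m<1+n k<n , Qk)))
  (cong (λ b → if b then 1 else 0) (dec-false (Q? n) (λ Qn → <-irrefl (unique (≤-refl , Qn)) j<n)))

∑<-length-filter : ∀ n {P : ℕ → A → Set} (P? : ∀ j → Decidable (P j)) xs →
  (∀ {x} → x ∈ xs → ∑< n (λ j → indicator (P? j x)) ≡ 1) →
  ∑< n (λ j → length (filter (P? j) xs)) ≡ length xs
∑<-length-filter n P? []       _   = ∑<-zero n (λ _ → refl)
∑<-length-filter n P? (x ∷ xs) one = begin
  ∑< n (λ j → length (filter (P? j) (x ∷ xs)))
    ≡⟨ ∑<-cong n (λ {j} _ → length-filter-∷ (P? j) x xs) ⟩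
  ∑< n (λ j → indicator (P? j x) + length (filter (P? j) xs))
    ≡⟨ ∑<-distrib-+ n _ _ ⟩
  ∑< n (λ j → indicator (P? j x)) + ∑< n (λ j → length (filter (P? j) xs))
    ≡⟨ cong₂ _+_ (one (here refl)) (∑<-length-filter n P? xs (one ∘ there)) ⟩
  suc (length xs) ∎

module _ {P : A → Set} (P? : Decidable P) (n : ℕ) (ρ : ℕ → A → A) {U : List A} (U! : Unique U)
         (ρ-closed : ∀ {j x} → x ∈ U → ρ j x ∈ U)
         (ρ-inverse : ∀ {j x} → j ≤ n → x ∈ U → ρ (n ∸ j) (ρ j x) ≡ x)
         where

  private
    ρ-inverseʳ : ∀ {j y} → j ≤ n → y ∈ U → ρ j (ρ (n ∸ j) y) ≡ y
    ρ-inverseʳ {j} {y} j≤n y∈ = subst (λ k → ρ k (ρ (n ∸ j) y) ≡ y) (m∸[m∸n]≡n j≤n) (ρ-inverse (m∸n≤m n j) y∈)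

  length-filter-∘ρ : ∀ {j} → j ≤ n → length (filter (P? ∘ ρ j) U) ≡ length (filter P? U)
  length-filter-∘ρ {j} j≤n =
    length-≡-from-inverses (ρ j) (ρ (n ∸ j)) (Unique.filter⁺ (P? ∘ ρ j) U!) (Unique.filter⁺ P? U!) forth back
      (λ x∈ → ρ-inverse j≤n (proj₁ (∈-filter⁻ (P? ∘ ρ j) x∈)))
      (λ y∈ → ρ-inverseʳ j≤n (proj₁ (∈-filter⁻ P? y∈)))
    where
    forth : ∀ {x} → x ∈ filter (P? ∘ ρ j) U → ρ j x ∈ filter P? U
    forth x∈ with ∈-filter⁻ (P? ∘ ρ j) x∈
    ... | x∈U , Pρx = ∈-filter⁺ P? (ρ-closed x∈U) Pρx
    back : ∀ {y} → y ∈ filter P? U → ρ (n ∸ j) y ∈ filter (P? ∘ ρ j) U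
    back y∈ with ∈-filter⁻ P? y∈
    ... | y∈U , Py = ∈-filter⁺ (P? ∘ ρ j) (ρ-closed y∈U) (subst P (sym (ρ-inverseʳ j≤n y∈U)) Py)

  -- Double counting the pairs (x , j) with P (ρ j x).
  orbit-count : (∀ {x} → x ∈ U → ∃! _≡_ λ j → j < n × P (ρ j x)) → n * length (filter P? U) ≡ length U
  orbit-count unique-j = begin
    n * length (filter P? U)                   ≡⟨ ∑<-const n _ ⟨
    ∑< n (λ _ → length (filter P? U))          ≡⟨ ∑<-cong n (λ j<n → length-filter-∘ρ (<⇒≤ j<n)) ⟨
    ∑< n (λ j → length (filter (P? ∘ ρ j) U))  ≡⟨ ∑<-length-filter n (λ j → P? ∘ ρ j) U
                                                     (λ x∈ → ∑<-indicator-unique n (λ j → P? (ρ j _)) (unique-j x∈)) ⟩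
    length U                                   ∎

-- The cycle lemma

lastMinimum : ∀ n (f : ℕ → ℤ) → 0 < n →
  ∃ λ j → j < n × (∀ {k} → k < n → f j ℤ.≤ f k) × (∀ {k} → j < k → k < n → f j ℤ.< f k)
lastMinimum (suc zero) f _ = 0 , s≤s z≤n , (λ { (s≤s z≤n) → ℤ.≤-refl }) , λ { (s≤s _) (s≤s ()) }
lastMinimum (suc (suc n)) f _ with lastMinimum (suc n) f (s≤s z≤n)
... | j , j<n , minimal , strict with f (suc n) ℤ.≤? f j
...   | yes fn≤fj = suc n , ≤-refl , minimal′ , λ n<k k<n+2 → contradiction k<n+2 (<⇒≱ (s≤s n<k))
  where
  minimal′ : ∀ {k} → k < suc (suc n) → f (suc n) ℤ.≤ f k
  minimal′ k<n+2 with m<1+n⇒m<n∨m≡n k<n+2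
  ... | inj₁ k<n  = ℤ.≤-trans fn≤fj (minimal k<n)
  ... | inj₂ refl = ℤ.≤-refl
...   | no fn≰fj = j , m<n⇒m<1+n j<n , minimal′ , strict′
  where
  minimal′ : ∀ {k} → k < suc (suc n) → f j ℤ.≤ f k
  minimal′ k<n+2 with m<1+n⇒m<n∨m≡n k<n+2
  ... | inj₁ k<n  = minimal k<n
  ... | inj₂ refl = ℤ.<⇒≤ (ℤ.≰⇒> fn≰fj)
  strict′ : ∀ {k} → j < k → k < suc (suc n) → f j ℤ.< f k
  strict′ j<k k<n+2 with m<1+n⇒m<n∨m≡n k<n+2
  ... | inj₁ k<n  = strict j<k k<n
  ... | inj₂ refl = ℤ.≰⇒> fn≰fj

firstMinimum : ∀ n (f : ℕ → ℤ) → 0 < n →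
  ∃ λ j → j < n × (∀ {k} → k < n → f j ℤ.≤ f k) × (∀ {k} → k < j → f j ℤ.< f k)
firstMinimum (suc zero) f _ = 0 , s≤s z≤n , (λ { (s≤s z≤n) → ℤ.≤-refl }) , λ ()
firstMinimum (suc (suc n)) f _ with firstMinimum (suc n) f (s≤s z≤n)
... | j , j<n , minimal , strict with f (suc n) ℤ.<? f j
...   | yes fn<fj = suc n , ≤-refl , minimal′ , λ k<n → ℤ.<-≤-trans fn<fj (minimal k<n)
  where
  minimal′ : ∀ {k} → k < suc (suc n) → f (suc n) ℤ.≤ f k
  minimal′ k<n+2 with m<1+n⇒m<n∨m≡n k<n+2
  ... | inj₁ k<n  = ℤ.≤-trans (ℤ.<⇒≤ fn<fj) (minimal k<n)
  ... | inj₂ refl = ℤ.≤-refl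
...   | no fn≮fj = j , m<n⇒m<1+n j<n , minimal′ , strict
  where
  minimal′ : ∀ {k} → k < suc (suc n) → f j ℤ.≤ f k
  minimal′ k<n+2 with m<1+n⇒m<n∨m≡n k<n+2
  ... | inj₁ k<n  = minimal k<n
  ... | inj₂ refl = ℤ.≮⇒≥ fn≮fj

inner-or-wrap : ∀ {j M n} → j ≤ n → j + M < n ⊎ ∃ λ i → M ≡ n ∸ j + i
inner-or-wrap {j} {M} {n} j≤n with j + M <? n
... | yes j+M<n = inj₁ j+M<n
... | no  j+M≮n = inj₂ (M ∸ (n ∸ j) , sym (m+[n∸m]≡n (m≤n+o⇒m∸n≤o n j (≮⇒≥ j+M≮n))))

wrap-index-≤ : ∀ {i j n} → j ≤ n → n ∸ j + i ≤ n → i ≤ j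
wrap-index-≤ {i} {j} {n} j≤n le = +-cancelˡ-≤ (n ∸ j) i j (subst (n ∸ j + i ≤_) (sym (m∸n+n≡m j≤n)) le)

wrap-index-< : ∀ {i j n} → j ≤ n → n ∸ j + i < n → i < j
wrap-index-< {i} {j} {n} j≤n lt = +-cancelˡ-< (n ∸ j) i j (subst (n ∸ j + i <_) (sym (m∸n+n≡m j≤n)) lt)

exclusive⇒unique : ∀ {Q : ℕ → Set} → (∀ {a b} → a < b → Q a → Q b → ⊥) → ∀ {j k} → Q j → Q k → j ≡ k
exclusive⇒unique exclusive {j} {k} Qj Qk with <-cmp j k
... | tri< j<k _ _ = contradiction Qk (exclusive j<k Qj)
... | tri≈ _ j≡k _ = j≡k
... | tri> _ _ k<j = contradiction Qj (exclusive k<j Qk)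

pos-difference : ∀ a b {c} → a + b ≡ c → + b ≡ + c - + a
pos-difference a b refl = trans (identity (+ a) (+ b)) (cong (_- + a) (sym (ℤ.pos-+ a b)))
  where
  identity : ∀ x y → y ≡ (x ℤ.+ y) - x
  identity = ℤ.solve-∀

module _ (s : ℕ) where

  -- A path at (x , k t) followed by blocks with es east steps passes right of every corner it reaches.
  ClearsCorners : ℕ → ℕ → List ℕ → Set
  ClearsCorners x k []       = ⊤
  ClearsCorners x k (e ∷ es) = suc k * s < x + e × ClearsCorners (x + e) (suc k) es

  clearsCorners? : ∀ x k es → Dec (ClearsCorners x k es)
  clearsCorners? x k []       = yes tt
  clearsCorners? x k (e ∷ es) = (suc k * s <? x + e) ×-dec clearsCorners? (x + e) (suc k) es

  clearsCorners⇔ : ∀ x k es →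
    ClearsCorners x k es ⇔ (∀ {M} → 0 < M → M ≤ length es → (k + M) * s < x + prefixSum M es)
  clearsCorners⇔ x k []       = mk⇔ (λ _ {_} 0<M M≤0 → contradiction M≤0 (<⇒≱ 0<M)) (λ _ → tt)
  clearsCorners⇔ x k (e ∷ es) = mk⇔ to from
    where
    first : (suc k * s < x + e) ≡ ((k + 1) * s < x + (e + 0))
    first = cong₂ (λ a b → a * s < b) (sym (+-comm k 1)) (cong (_+_ x) (sym (+-identityʳ e)))
    later : ∀ m → ((suc k + m) * s < x + e + prefixSum m es) ≡ ((k + suc m) * s < x + (e + prefixSum m es))
    later m = cong₂ (λ a b → a * s < b) (sym (+-suc k m)) (+-assoc x e (prefixSum m es))
    to : ClearsCorners x k (e ∷ es) →
      ∀ {M} → 0 < M → M ≤ suc (length es) → (k + M) * s < x + prefixSum M (e ∷ es)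
    to (corner , _)    {suc zero}    _ _         = subst id first corner
    to (_ , clears)    {suc (suc m)} _ (s≤s m≤n) =
      subst id (later (suc m)) (Equivalence.to (clearsCorners⇔ (x + e) (suc k) es) clears (s≤s z≤n) m≤n)
    from : (∀ {M} → 0 < M → M ≤ suc (length es) → (k + M) * s < x + prefixSum M (e ∷ es)) →
      ClearsCorners x k (e ∷ es)
    from h = subst id (sym first) (h (s≤s z≤n) (s≤s z≤n)) ,
      Equivalence.from (clearsCorners⇔ (x + e) (suc k) es) (λ {m} _ m≤n → subst id (sym (later m)) (h (s≤s z≤n) (s≤s m≤n)))

  excess : List ℕ → ℕ → ℤ
  excess xs M = + prefixSum M xs - + (M * s)

  ExcessPositive : List ℕ → Set
  ExcessPositive xs = ∀ {M} → 0 < M → M ≤ length xs → 0ℤ ℤ.< excess xs M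

  ExcessNonNegative : List ℕ → Set
  ExcessNonNegative xs = ∀ {M} → 0 < M → M < length xs → 0ℤ ℤ.≤ excess xs M

  private
    <⇒0<- : ∀ {a b} → a ℤ.< b → 0ℤ ℤ.< b - a
    <⇒0<- {a} {b} a<b = subst (ℤ._< b - a) (ℤ.+-inverseʳ a) (ℤ.+-monoˡ-< (ℤ.- a) a<b)

    0≤⇒0<1+ : ∀ {x} → 0ℤ ℤ.≤ x → 0ℤ ℤ.< 1ℤ ℤ.+ x
    0≤⇒0<1+ 0≤x = ℤ.suc[i]≤j⇒i<j (ℤ.suc-mono 0≤x)

    positive-sum-≢1 : ∀ {x y} → 0ℤ ℤ.< x → 0ℤ ℤ.< y → x ℤ.+ y ≢ 1ℤ
    positive-sum-≢1 0<x 0<y x+y≡1 =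
      ℤ.<-irrefl refl (subst (1ℤ ℤ.<_) x+y≡1 (ℤ.+-mono-≤-< (ℤ.i<j⇒suc[i]≤j 0<x) 0<y))

    nonNegative-sum-≢-1 : ∀ {x y} → 0ℤ ℤ.≤ x → 0ℤ ℤ.≤ y → x ℤ.+ y ≢ -1ℤ
    nonNegative-sum-≢-1 0≤x 0≤y x+y≡-1 with subst (0ℤ ℤ.≤_) x+y≡-1 (ℤ.+-mono-≤ 0≤x 0≤y)
    ... | ()

    <⇔0<- : ∀ {m n} → m < n ⇔ 0ℤ ℤ.< + n - + m
    <⇔0<- {m} {n} = mk⇔ (λ m<n → <⇒0<- (ℤ.+<+ m<n))
      (λ 0<n-m → ℤ.drop‿+<+ (subst (+ m ℤ.<_) (cancel (+ n) (+ m)) (ℤ.+-monoˡ-< (+ m) 0<n-m)))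
      where
      cancel : ∀ a b → (a - b) ℤ.+ b ≡ a
      cancel = ℤ.solve-∀

    ≤⇔0≤- : ∀ {m n} → m ≤ n ⇔ 0ℤ ℤ.≤ + n - + m
    ≤⇔0≤- = mk⇔ (λ m≤n → ℤ.i≤j⇒0≤j-i (ℤ.+≤+ m≤n)) (λ 0≤n-m → ℤ.drop‿+≤+ (ℤ.0≤i-j⇒j≤i 0≤n-m))

  clearsCorners⇔excessPositive : ∀ es → ClearsCorners 0 0 es ⇔ ExcessPositive es
  clearsCorners⇔excessPositive es = mk⇔
    (λ clears {M} 0<M M≤n → Equivalence.to <⇔0<- (Equivalence.to (clearsCorners⇔ 0 0 es) clears 0<M M≤n))
    (λ positive → Equivalence.from (clearsCorners⇔ 0 0 es)
      (λ {M} 0<M M≤n → Equivalence.from <⇔0<- (positive 0<M M≤n)))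

  clearsCorners⇔excessNonNegative : ∀ es → ClearsCorners 1 0 (dropLast es) ⇔ ExcessNonNegative es
  clearsCorners⇔excessNonNegative es = mk⇔
    (λ clears {M} 0<M M<n → Equivalence.to ≤⇔0≤-
      (≤-pred (subst (λ P → M * s < 1 + P) (cong sum (take-dropLast M es M<n))
        (Equivalence.to (clearsCorners⇔ 1 0 (dropLast es)) clears 0<M
          (subst (M ≤_) (sym (length-dropLast es)) (<⇒≤pred M<n))))))
    (λ nonNegative → Equivalence.from (clearsCorners⇔ 1 0 (dropLast es)) (λ {M} 0<M M≤n-1 →
      let M<n = positive-≤pred⇒< 0<M (subst (M ≤_) (length-dropLast es) M≤n-1) in
      subst (λ P → M * s < 1 + P) (sym (cong sum (take-dropLast M es M<n)))
            (s≤s (Equivalence.from ≤⇔0≤- (nonNegative 0<M M<n)))))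
    where
    positive-≤pred⇒< : ∀ {m n} → 0 < m → m ≤ pred n → m < n
    positive-≤pred⇒< {n = zero}  0<m m≤0 = contradiction m≤0 (<⇒≱ 0<m)
    positive-≤pred⇒< {n = suc n} _   m≤n = s≤s m≤n

  excess-rotate-inner : ∀ j M xs → j + M ≤ length xs →
    excess (rotate j xs) M ≡ excess xs (j + M) - excess xs j
  excess-rotate-inner j M xs j+M≤n =
    trans (cong₂ _-_ (pos-difference (prefixSum j xs) _ (prefixSum-rotate-inner j M xs j+M≤n))
                     (pos-difference (j * s) (M * s) (sym (*-distribʳ-+ s j M))))
          (identity (+ prefixSum (j + M) xs) (+ prefixSum j xs) (+ ((j + M) * s)) (+ (j * s)))
    where
    identity : ∀ C A c a → (C - A) - (c - a) ≡ (C - c) - (A - a)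
    identity = ℤ.solve-∀

  excess-rotate-wrap : ∀ {i j} xs → i ≤ j → j ≤ length xs →
    excess (rotate j xs) (length xs ∸ j + i) ≡ (+ sum xs - + (length xs * s)) - excess xs j ℤ.+ excess xs i
  excess-rotate-wrap {i} {j} xs i≤j j≤n =
    trans (cong₂ _-_ (trans (pos-difference (prefixSum j xs) _ (prefixSum-rotate-wrap xs i≤j))
                            (cong (_- + prefixSum j xs) (ℤ.pos-+ (sum xs) (prefixSum i xs))))
                     (trans (pos-difference (j * s) _ multiples)
                            (cong (_- + (j * s)) (ℤ.pos-+ (length xs * s) (i * s)))))
          (identity (+ sum xs) (+ prefixSum i xs) (+ prefixSum j xs) (+ (length xs * s)) (+ (i * s)) (+ (j * s)))
    where
    multiples : j * s + (length xs ∸ j + i) * s ≡ length xs * s + i * s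
    multiples = begin
      j * s + (length xs ∸ j + i) * s         ≡⟨ cong (_+_ (j * s)) (*-distribʳ-+ s (length xs ∸ j) i) ⟩
      j * s + ((length xs ∸ j) * s + i * s)   ≡⟨ +-assoc (j * s) _ _ ⟨
      j * s + (length xs ∸ j) * s + i * s     ≡⟨ cong (_+ i * s) (*-distribʳ-+ s j (length xs ∸ j)) ⟨
      (j + (length xs ∸ j)) * s + i * s       ≡⟨ cong (λ k → k * s + i * s) (m+[n∸m]≡n j≤n) ⟩
      length xs * s + i * s                   ∎
    identity : ∀ S I A c d a → ((S ℤ.+ I) - A) - ((c ℤ.+ d) - a) ≡ (S - c) - (A - a) ℤ.+ (I - d)
    identity = ℤ.solve-∀

  excess-total-surplus : ∀ xs → sum xs ≡ length xs * s + 1 → + sum xs - + (length xs * s) ≡ 1ℤ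
  excess-total-surplus xs total = sym (pos-difference (length xs * s) 1 (sym total))

  excess-total-deficit : ∀ xs → sum xs + 1 ≡ length xs * s → + sum xs - + (length xs * s) ≡ -1ℤ
  excess-total-deficit xs total =
    trans (identity (+ (length xs * s)) (+ sum xs)) (cong ℤ.-_ (sym (pos-difference (sum xs) 1 total)))
    where
    identity : ∀ c a → a - c ≡ ℤ.- (c - a)
    identity = ℤ.solve-∀

  -- With P = excess xs, good rotations a < b would force both 0 < P b − P a and 0 < 1 − (P b − P a).
  excessPositive-exclusive : ∀ xs → sum xs ≡ length xs * s + 1 → ∀ {a b} → a < b →
    a < length xs × ExcessPositive (rotate a xs) → b < length xs × ExcessPositive (rotate b xs) → ⊥
  excessPositive-exclusive xs total {a} {b} a<b (a<n , positive-a) (b<n , positive-b) =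
    positive-sum-≢1 (subst (0ℤ ℤ.<_) rise (positive-a (m<n⇒0<n∸m a<b) b-a≤n))
                    (subst (0ℤ ℤ.<_) fall (positive-b (≤-trans (m<n⇒0<n∸m b<n) (m≤m+n (n ∸ b) a)) n-b+a≤n))
                    (identity (excess xs a) (excess xs b))
    where
    n = length xs
    b-a≤n : b ∸ a ≤ length (rotate a xs)
    b-a≤n = ≤-trans (m∸n≤m b a) (≤-trans (<⇒≤ b<n) (≤-reflexive (sym (length-rotate a xs))))
    n-b+a≤n : n ∸ b + a ≤ length (rotate b xs)
    n-b+a≤n = subst (n ∸ b + a ≤_) (trans (m∸n+n≡m (<⇒≤ b<n)) (sym (length-rotate b xs)))
                    (+-monoʳ-≤ (n ∸ b) (<⇒≤ a<b))
    rise : excess (rotate a xs) (b ∸ a) ≡ excess xs b - excess xs a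
    rise = trans (excess-rotate-inner a (b ∸ a) xs (subst (_≤ n) (sym (m+[n∸m]≡n (<⇒≤ a<b))) (<⇒≤ b<n)))
                 (cong (λ k → excess xs k - excess xs a) (m+[n∸m]≡n (<⇒≤ a<b)))
    fall : excess (rotate b xs) (n ∸ b + a) ≡ 1ℤ - excess xs b ℤ.+ excess xs a
    fall = trans (excess-rotate-wrap xs (<⇒≤ a<b) (<⇒≤ b<n))
                 (cong (λ σ → σ - excess xs b ℤ.+ excess xs a) (excess-total-surplus xs total))
    identity : ∀ Pa Pb → (Pb - Pa) ℤ.+ (1ℤ - Pb ℤ.+ Pa) ≡ 1ℤ
    identity = ℤ.solve-∀

  excessNonNegative-exclusive : ∀ xs → sum xs + 1 ≡ length xs * s → ∀ {a b} → a < b →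
    a < length xs × ExcessNonNegative (rotate a xs) → b < length xs × ExcessNonNegative (rotate b xs) → ⊥
  excessNonNegative-exclusive xs total {a} {b} a<b (a<n , nonNegative-a) (b<n , nonNegative-b) =
    nonNegative-sum-≢-1 (subst (0ℤ ℤ.≤_) rise (nonNegative-a (m<n⇒0<n∸m a<b) b-a<n))
                        (subst (0ℤ ℤ.≤_) fall (nonNegative-b (≤-trans (m<n⇒0<n∸m b<n) (m≤m+n (n ∸ b) a)) n-b+a<n))
                        (identity (excess xs a) (excess xs b))
    where
    n = length xs
    b-a<n : b ∸ a < length (rotate a xs)
    b-a<n = ≤-<-trans (m∸n≤m b a) (<-≤-trans b<n (≤-reflexive (sym (length-rotate a xs))))
    n-b+a<n : n ∸ b + a < length (rotate b xs)
    n-b+a<n = subst (n ∸ b + a <_) (trans (m∸n+n≡m (<⇒≤ b<n)) (sym (length-rotate b xs))) (+-monoʳ-< (n ∸ b) a<b)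
    rise : excess (rotate a xs) (b ∸ a) ≡ excess xs b - excess xs a
    rise = trans (excess-rotate-inner a (b ∸ a) xs (subst (_≤ n) (sym (m+[n∸m]≡n (<⇒≤ a<b))) (<⇒≤ b<n)))
                 (cong (λ k → excess xs k - excess xs a) (m+[n∸m]≡n (<⇒≤ a<b)))
    fall : excess (rotate b xs) (n ∸ b + a) ≡ -1ℤ - excess xs b ℤ.+ excess xs a
    fall = trans (excess-rotate-wrap xs (<⇒≤ a<b) (<⇒≤ b<n))
                 (cong (λ σ → σ - excess xs b ℤ.+ excess xs a) (excess-total-deficit xs total))
    identity : ∀ Pa Pb → (Pb - Pa) ℤ.+ (-1ℤ - Pb ℤ.+ Pa) ≡ -1ℤ
    identity = ℤ.solve-∀

  -- The rotation starting after the last minimum of the excess.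
  cycleLemma-positive : ∀ xs → 0 < length xs → sum xs ≡ length xs * s + 1 →
    ∃! _≡_ λ j → j < length xs × ExcessPositive (rotate j xs)
  cycleLemma-positive xs 0<n total with lastMinimum (length xs) (excess xs) 0<n
  ... | j , j<n , minimal , strict =
    j , (j<n , positive) , exclusive⇒unique (excessPositive-exclusive xs total) (j<n , positive)
    where
    n = length xs
    positive : ExcessPositive (rotate j xs)
    positive {M} 0<M M≤n′ with inner-or-wrap {j} {M} (<⇒≤ j<n)
    ... | inj₁ j+M<n =
      subst (0ℤ ℤ.<_) (sym (excess-rotate-inner j M xs (<⇒≤ j+M<n)))
            (<⇒0<- (strict (m<m+n j 0<M) j+M<n))
    ... | inj₂ (i , refl) =
      subst (0ℤ ℤ.<_) (sym (trans (excess-rotate-wrap xs i≤j (<⇒≤ j<n)) (shape (excess xs j) (excess xs i))))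
            (0≤⇒0<1+ (ℤ.i≤j⇒0≤j-i (minimal (≤-<-trans i≤j j<n))))
      where
      i≤j : i ≤ j
      i≤j = wrap-index-≤ (<⇒≤ j<n) (subst (n ∸ j + i ≤_) (length-rotate j xs) M≤n′)
      identity : ∀ Pj Pi → 1ℤ - Pj ℤ.+ Pi ≡ 1ℤ ℤ.+ (Pi - Pj)
      identity = ℤ.solve-∀
      shape : ∀ Pj Pi → (+ sum xs - + (n * s)) - Pj ℤ.+ Pi ≡ 1ℤ ℤ.+ (Pi - Pj)
      shape Pj Pi = trans (cong (λ σ → σ - Pj ℤ.+ Pi) (excess-total-surplus xs total)) (identity Pj Pi)

  -- The rotation starting at the first minimum of the excess.
  cycleLemma-nonNegative : ∀ xs → 0 < length xs → sum xs + 1 ≡ length xs * s →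
    ∃! _≡_ λ j → j < length xs × ExcessNonNegative (rotate j xs)
  cycleLemma-nonNegative xs 0<n total with firstMinimum (length xs) (excess xs) 0<n
  ... | j , j<n , minimal , strict =
    j , (j<n , nonNegative) , exclusive⇒unique (excessNonNegative-exclusive xs total) (j<n , nonNegative)
    where
    n = length xs
    nonNegative : ExcessNonNegative (rotate j xs)
    nonNegative {M} 0<M M<n′ with inner-or-wrap {j} {M} (<⇒≤ j<n)
    ... | inj₁ j+M<n =
      subst (0ℤ ℤ.≤_) (sym (excess-rotate-inner j M xs (<⇒≤ j+M<n)))
            (ℤ.i≤j⇒0≤j-i (minimal j+M<n))
    ... | inj₂ (i , refl) =
      subst (0ℤ ℤ.≤_) (sym (trans (excess-rotate-wrap xs (<⇒≤ i<j) (<⇒≤ j<n)) (shape (excess xs j) (excess xs i))))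
            (ℤ.i≤j⇒0≤j-i (ℤ.i<j⇒suc[i]≤j (strict i<j)))
      where
      i<j : i < j
      i<j = wrap-index-< (<⇒≤ j<n) (subst (n ∸ j + i <_) (length-rotate j xs) M<n′)
      identity : ∀ Pj Pi → -1ℤ - Pj ℤ.+ Pi ≡ Pi - (1ℤ ℤ.+ Pj)
      identity = ℤ.solve-∀
      shape : ∀ Pj Pi → (+ sum xs - + (n * s)) - Pj ℤ.+ Pi ≡ Pi - (1ℤ ℤ.+ Pj)
      shape Pj Pi = trans (cong (λ σ → σ - Pj ℤ.+ Pi) (excess-total-deficit xs total)) (identity Pj Pi)

-- Lattice words, blocks and binomial coefficients

#E #N : List Step → ℕ
#E []      = 0
#E (E ∷ w) = suc (#E w)
#E (N ∷ w) = #E w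
#N []      = 0
#N (E ∷ w) = #N w
#N (N ∷ w) = suc (#N w)

#E-++ : ∀ u v → #E (u ++ v) ≡ #E u + #E v
#E-++ []      v = refl
#E-++ (E ∷ u) v = cong suc (#E-++ u v)
#E-++ (N ∷ u) v = #E-++ u v

#N-++ : ∀ u v → #N (u ++ v) ≡ #N u + #N v
#N-++ []      v = refl
#N-++ (E ∷ u) v = #N-++ u v
#N-++ (N ∷ u) v = cong suc (#N-++ u v)

#E-∷ʳN : ∀ u → #E (u ∷ʳ N) ≡ #E u
#E-∷ʳN u = trans (#E-++ u (N ∷ [])) (+-identityʳ (#E u))

#N-∷ʳN : ∀ u → #N (u ∷ʳ N) ≡ suc (#N u)
#N-∷ʳN u = trans (#N-++ u (N ∷ [])) (+-comm (#N u) 1)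

#E-concat : ∀ ws → #E (concat ws) ≡ sum (map #E ws)
#E-concat []       = refl
#E-concat (w ∷ ws) = trans (#E-++ w (concat ws)) (cong (_+_ (#E w)) (#E-concat ws))

words : ℕ → ℕ → List (List Step)
words zero    zero    = [] ∷ []
words (suc a) zero    = map (E ∷_) (words a zero)
words zero    (suc b) = map (N ∷_) (words zero b)
words (suc a) (suc b) = map (E ∷_) (words a (suc b)) ++ map (N ∷_) (words (suc a) b)

∈-words⁻ : ∀ a b {w} → w ∈ words a b → #E w ≡ a × #N w ≡ b
∈-words⁻ zero    zero    (here refl) = refl , refl
∈-words⁻ (suc a) zero    w∈ with ∈-map⁻ (E ∷_) w∈
... | v , v∈ , refl = map₁ (cong suc) (∈-words⁻ a zero v∈)
∈-words⁻ zero    (suc b) w∈ with ∈-map⁻ (N ∷_) w∈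
... | v , v∈ , refl = map₂ (cong suc) (∈-words⁻ zero b v∈)
∈-words⁻ (suc a) (suc b) w∈ with ∈-++⁻ (map (E ∷_) (words a (suc b))) w∈
... | inj₁ w∈ᴱ with ∈-map⁻ (E ∷_) w∈ᴱ
...   | v , v∈ , refl = map₁ (cong suc) (∈-words⁻ a (suc b) v∈)
∈-words⁻ (suc a) (suc b) w∈ | inj₂ w∈ᴺ with ∈-map⁻ (N ∷_) w∈ᴺ
...   | v , v∈ , refl = map₂ (cong suc) (∈-words⁻ (suc a) b v∈)

∈-words⁺ : ∀ w → w ∈ words (#E w) (#N w)
∈-words⁺ []      = here refl
∈-words⁺ (E ∷ w) with #N w | ∈-words⁺ w
... | zero  | w∈ = ∈-map⁺ (E ∷_) w∈
... | suc b | w∈ = ∈-++⁺ˡ (∈-map⁺ (E ∷_) w∈)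
∈-words⁺ (N ∷ w) with #E w | ∈-words⁺ w
... | zero  | w∈ = ∈-map⁺ (N ∷_) w∈
... | suc a | w∈ = ∈-++⁺ʳ (map (E ∷_) (words a (suc (#N w)))) (∈-map⁺ (N ∷_) w∈)

∈-words : ∀ a b {w} → w ∈ words a b ⇔ (#E w ≡ a × #N w ≡ b)
∈-words a b {w} = mk⇔ (∈-words⁻ a b) λ (#E≡ , #N≡) → subst₂ (λ a b → w ∈ words a b) #E≡ #N≡ (∈-words⁺ w)

words-Unique : ∀ a b → Unique (words a b)
words-Unique zero    zero    = [] ∷ []
words-Unique (suc a) zero    = Unique.map⁺ ∷-injectiveʳ (words-Unique a zero)
words-Unique zero    (suc b) = Unique.map⁺ ∷-injectiveʳ (words-Unique zero b)
words-Unique (suc a) (suc b) =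
  Unique.++⁺ (Unique.map⁺ ∷-injectiveʳ (words-Unique a (suc b))) (Unique.map⁺ ∷-injectiveʳ (words-Unique (suc a) b))
             disjoint
  where
  disjoint : ∀ {w} → ¬ (w ∈ map (E ∷_) (words a (suc b)) × w ∈ map (N ∷_) (words (suc a) b))
  disjoint (w∈ᴱ , w∈ᴺ) with ∈-map⁻ (E ∷_) w∈ᴱ | ∈-map⁻ (N ∷_) w∈ᴺ
  ... | _ , _ , refl | _ , _ , ()

nC0≡1 : ∀ n → n C 0 ≡ 1
nC0≡1 n = trans (nCk≡nC[n∸k] {0} {n} z≤n) (nCn≡1 n)

length-words : ∀ a b → length (words a b) ≡ (a + b) C b
length-words zero    zero    = refl
length-words (suc a) zero    = begin
  length (map (E ∷_) (words a zero))   ≡⟨ length-map (E ∷_) (words a zero) ⟩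
  length (words a zero)                ≡⟨ length-words a zero ⟩
  (a + 0) C 0                          ≡⟨ nC0≡1 (a + 0) ⟩
  1                                    ≡⟨ nC0≡1 (suc a + 0) ⟨
  (suc a + 0) C 0                      ∎
length-words zero    (suc b) = begin
  length (map (N ∷_) (words zero b))   ≡⟨ length-map (N ∷_) (words zero b) ⟩
  length (words zero b)                ≡⟨ length-words zero b ⟩
  b C b                                ≡⟨ nCn≡1 b ⟩
  1                                    ≡⟨ nCn≡1 (suc b) ⟨
  suc b C suc b                        ∎
length-words (suc a) (suc b) = begin
  length (map (E ∷_) (words a (suc b)) ++ map (N ∷_) (words (suc a) b))
    ≡⟨ length-++ (map (E ∷_) (words a (suc b))) ⟩
  length (map (E ∷_) (words a (suc b))) + length (map (N ∷_) (words (suc a) b))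
    ≡⟨ cong₂ _+_ (length-map (E ∷_) (words a (suc b))) (length-map (N ∷_) (words (suc a) b)) ⟩
  length (words a (suc b)) + length (words (suc a) b)
    ≡⟨ cong₂ _+_ (length-words a (suc b)) (trans (length-words (suc a) b) (cong (_C b) (sym (+-suc a b)))) ⟩
  (a + suc b) C suc b + (a + suc b) C b
    ≡⟨ +-comm ((a + suc b) C suc b) _ ⟩
  (a + suc b) C b + (a + suc b) C suc b
    ≡⟨ nCk+nC[k+1]≡[n+1]C[k+1] (a + suc b) b ⟩
  suc (a + suc b) C suc b ∎

absorption : ∀ a b → suc b * ((a + suc b) C suc b) ≡ suc a * ((a + suc b) C b)
absorption zero b = begin
  suc b * (suc b C suc b)   ≡⟨ cong (suc b *_) (nCn≡1 (suc b)) ⟩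
  suc b * 1                 ≡⟨ *-identityʳ (suc b) ⟩
  suc b                     ≡⟨ nC1≡n (suc b) ⟨
  suc b C 1                 ≡⟨ nCk≡nC[n∸k] (s≤s (z≤n {b})) ⟩
  suc b C b                 ≡⟨ *-identityˡ (suc b C b) ⟨
  1 * (suc b C b)           ∎
absorption (suc a) zero = begin
  1 * ((suc a + 1) C 1)             ≡⟨ *-identityˡ _ ⟩
  (suc a + 1) C 1                   ≡⟨ nC1≡n (suc a + 1) ⟩
  suc a + 1                         ≡⟨ +-comm (suc a) 1 ⟩
  suc (suc a)                       ≡⟨ *-identityʳ (suc (suc a)) ⟨
  suc (suc a) * 1                   ≡⟨ cong (suc (suc a) *_) (nC0≡1 (suc a + 1)) ⟨
  suc (suc a) * ((suc a + 1) C 0)   ∎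
absorption (suc a) (suc b) = begin
  suc (suc b) * (suc m C suc (suc b))
    ≡⟨ cong (suc (suc b) *_) (nCk+nC[k+1]≡[n+1]C[k+1] m (suc b)) ⟨
  suc (suc b) * (m C suc b + m C suc (suc b))
    ≡⟨ expand (m C suc b) (m C suc (suc b)) b ⟩
  m C suc b + suc b * (m C suc b) + suc (suc b) * (m C suc (suc b))
    ≡⟨ cong₂ (λ u v → m C suc b + u + v) shifted (absorption a (suc b)) ⟩
  m C suc b + suc (suc a) * (m C b) + suc a * (m C suc b)
    ≡⟨ collect (m C suc b) (m C b) a ⟩
  suc (suc a) * (m C b + m C suc b)
    ≡⟨ cong (suc (suc a) *_) (nCk+nC[k+1]≡[n+1]C[k+1] m b) ⟩
  suc (suc a) * (suc m C suc b) ∎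
  where
  m = a + suc (suc b)
  shifted : suc b * (m C suc b) ≡ suc (suc a) * (m C b)
  shifted = subst (λ k → suc b * (k C suc b) ≡ suc (suc a) * (k C b)) (sym (+-suc a (suc b))) (absorption (suc a) b)
  expand : ∀ x y b → suc (suc b) * (x + y) ≡ x + suc b * x + suc (suc b) * y
  expand = solve-∀
  collect : ∀ x z a → x + suc (suc a) * z + suc a * x ≡ suc (suc a) * (z + x)
  collect = solve-∀

count⇒difference : ∀ n t s {L C X Y} .{{_ : NonZero n}} →
  n * L ≡ C → t * n * X ≡ C + s * n * Y → + L ≡ + t *ℤ + X - + s *ℤ + Y
count⇒difference n t s {L} {C} {X} {Y} count weighted =
  trans (pos-difference (s * Y) L (trans (+-comm (s * Y) L) (sym balance)))
        (cong₂ _-_ (ℤ.pos-* t X) (ℤ.pos-* s Y))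
  where
  balance : t * X ≡ L + s * Y
  balance = *-cancelˡ-≡ (t * X) (L + s * Y) n (begin
    n * (t * X)           ≡⟨ reassociate n t X ⟩
    t * n * X             ≡⟨ weighted ⟩
    C + s * n * Y         ≡⟨ cong (_+ s * n * Y) count ⟨
    n * L + s * n * Y     ≡⟨ distribute n L s Y ⟩
    n * (L + s * Y)       ∎)
    where
    reassociate : ∀ n t X → n * (t * X) ≡ t * n * X
    reassociate = solve-∀
    distribute : ∀ n L s Y → n * L + s * n * Y ≡ n * (L + s * Y)
    distribute = solve-∀

binom-below : ∀ a b → ∃ λ Y → binom (a + b) (+ suc b - + 2) ≡ + Y × b * ((a + b) C b) ≡ suc a * Y
binom-below a zero    = 0 , refl , sym (*-zeroʳ (suc a))
binom-below a (suc b) = (a + suc b) C b , refl , absorption a b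

IsBlock : ℕ → List Step → Set
IsBlock t b = ∃ λ u → suc (#N u) ≡ t × b ≡ u ∷ʳ N

splitAtNorth : ℕ → List Step → List Step × List Step
splitAtNorth k       []      = [] , []
splitAtNorth k       (E ∷ w) = map₁ (E ∷_) (splitAtNorth k w)
splitAtNorth zero    (N ∷ w) = [] , w
splitAtNorth (suc k) (N ∷ w) = map₁ (N ∷_) (splitAtNorth k w)

splitAtNorth-++ : ∀ {k} u r → #N u ≡ k → splitAtNorth k (u ++ N ∷ r) ≡ (u , r)
splitAtNorth-++ []      r refl = refl
splitAtNorth-++ (E ∷ u) r refl = cong (map₁ (E ∷_)) (splitAtNorth-++ u r refl)
splitAtNorth-++ (N ∷ u) r refl = cong (map₁ (N ∷_)) (splitAtNorth-++ u r refl)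

northStep : ∀ k w → k < #N w → ∃ λ u → ∃ λ r → #N u ≡ k × u ++ N ∷ r ≡ w
northStep k       (E ∷ w) k<n with northStep k w k<n
... | u , r , #N≡ , refl = E ∷ u , r , #N≡ , refl
northStep zero    (N ∷ w) _ = [] , w , refl , refl
northStep (suc k) (N ∷ w) (s≤s k<n) with northStep k w k<n
... | u , r , refl , refl = N ∷ u , r , refl , refl

-- Each block ends at a north step and contains suc t of them; whatever follows the n-th block is discarded.
blocks : ℕ → ℕ → List Step → List (List Step)
blocks t zero    w = []
blocks t (suc n) w = (proj₁ (splitAtNorth t w) ∷ʳ N) ∷ blocks t n (proj₂ (splitAtNorth t w))

length-blocks : ∀ t n w → length (blocks t n w) ≡ n
length-blocks t zero    w = refl
length-blocks t (suc n) w = cong suc (length-blocks t n _)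

blocks-concat : ∀ t {bs} → All (IsBlock (suc t)) bs → blocks t (length bs) (concat bs) ≡ bs
blocks-concat t []                                     = refl
blocks-concat t {_ ∷ bs} ((u , refl , refl) ∷ blocks′) = begin
  blocks t (suc (length bs)) ((u ∷ʳ N) ++ concat bs)
    ≡⟨ cong (blocks t (suc (length bs))) (++-assoc u (N ∷ []) (concat bs)) ⟩
  blocks t (suc (length bs)) (u ++ N ∷ concat bs)
    ≡⟨ cong (λ p → (proj₁ p ∷ʳ N) ∷ blocks t (length bs) (proj₂ p)) (splitAtNorth-++ u (concat bs) refl) ⟩
  (u ∷ʳ N) ∷ blocks t (length bs) (concat bs)
    ≡⟨ cong ((u ∷ʳ N) ∷_) (blocks-concat t blocks′) ⟩
  (u ∷ʳ N) ∷ bs ∎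

blocks-∷ʳ : ∀ t n u → suc (#N u) ≡ suc n * suc t →
  All (IsBlock (suc t)) (blocks t (suc n) (u ∷ʳ N)) × concat (blocks t (suc n) (u ∷ʳ N)) ≡ u ∷ʳ N
blocks-∷ʳ t zero u #N≡ rewrite splitAtNorth-++ u [] (trans (suc-injective #N≡) (+-identityʳ t)) =
  (u , cong suc (trans (suc-injective #N≡) (+-identityʳ t)) , refl) ∷ [] , ++-identityʳ (u ∷ʳ N)
blocks-∷ʳ t (suc n) u #N≡ with northStep t u (subst (t <_) (sym (suc-injective #N≡)) (m<m+n t (s≤s z≤n)))
... | u₁ , r , refl , refl
  rewrite ++-assoc u₁ (N ∷ r) (N ∷ []) | splitAtNorth-++ u₁ (r ∷ʳ N) refl
  with blocks-∷ʳ t n r (+-cancelˡ-≡ (suc t) _ _ (trans (cong suc (sym (#N-++ u₁ (N ∷ r)))) #N≡))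
... | rest-blocks , rest-concat =
  (u₁ , refl , refl) ∷ rest-blocks , trans (cong ((u₁ ∷ʳ N) ++_) rest-concat) (++-assoc u₁ (N ∷ []) (r ∷ʳ N))

concat-blocks-∷ʳN : ∀ {t b bs} → All (IsBlock t) (b ∷ bs) → ∃ λ v → concat (b ∷ bs) ≡ v ∷ʳ N
concat-blocks-∷ʳN ((u , _ , refl) ∷ [])                    = u , ++-identityʳ (u ∷ʳ N)
concat-blocks-∷ʳN {b = b} ((_ , _ , refl) ∷ rest@(_ ∷ _)) with concat-blocks-∷ʳN rest
... | v , concat≡ = b ++ v , trans (cong (b ++_) concat≡) (sym (++-assoc b v (N ∷ [])))

#N-concat-blocks : ∀ {t bs} → All (IsBlock t) bs → #N (concat bs) ≡ length bs * t
#N-concat-blocks []                        = refl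
#N-concat-blocks {bs = _ ∷ bs} ((u , #N≡ , refl) ∷ blocks′) =
  trans (#N-++ (u ∷ʳ N) (concat bs)) (cong₂ _+_ (trans (#N-∷ʳN u) #N≡) (#N-concat-blocks blocks′))

-- Paths and the staircase

visited : Point → List Step → List Point
visited p []       = []
visited p (d ∷ ds) = move p d ∷ visited (move p d) ds

points≡∷visited : ∀ p ds → points p ds ≡ p ∷ visited p ds
points≡∷visited p []       = refl
points≡∷visited p (d ∷ ds) = cong (p ∷_) (points≡∷visited (move p d) ds)

visited-++ : ∀ p u v → visited p (u ++ v) ≡ visited p u ++ visited (endpoint p u) v
visited-++ p []      v = refl
visited-++ p (d ∷ u) v = cong (move p d ∷_) (visited-++ (move p d) u v)

endpoint-++ : ∀ p u v → endpoint p (u ++ v) ≡ endpoint (endpoint p u) v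
endpoint-++ p []      v = refl
endpoint-++ p (d ∷ u) v = endpoint-++ (move p d) u v

endpoint-counts : ∀ x y w → endpoint (x , y) w ≡ (x + #E w , y + #N w)
endpoint-counts x y []      = cong₂ _,_ (sym (+-identityʳ x)) (sym (+-identityʳ y))
endpoint-counts x y (E ∷ w) = trans (endpoint-counts (suc x) y w) (cong (_, y + #N w) (sym (+-suc x (#E w))))
endpoint-counts x y (N ∷ w) = trans (endpoint-counts x (suc y) w) (cong (x + #E w ,_) (sym (+-suc y (#N w))))

All-points-endpoint : ∀ {P : Point → Set} p u v → All P (points p (u ++ v)) → P (endpoint p u)
All-points-endpoint p []      []      (Pp ∷ _) = Pp
All-points-endpoint p []      (d ∷ v) (Pp ∷ _) = Pp
All-points-endpoint p (d ∷ u) v       (_ ∷ Ps) = All-points-endpoint (move p d) u v Ps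

module _ (s t : ℕ) .{{_ : NonZero t}} where

  RightOfStairs : Point → Set
  RightOfStairs (x , y) = ∀ j → suc j * t ≤ y → suc j * s < x

  RightOfStairs⇒¬OnA : ∀ {p} → RightOfStairs p → ¬ OnA s t p
  RightOfStairs⇒¬OnA right (k , inj₁ (_ , x≤ , refl))     = <⇒≱ (right k ≤-refl) x≤
  RightOfStairs⇒¬OnA right (k , inj₂ (refl , k+1≤y , _)) = <-irrefl refl (right k k+1≤y)

  -- A north step from the right of the staircase can only meet it at a horizontal run.
  RightOfStairs-move : ∀ {p} d → RightOfStairs p → ¬ OnA s t (move p d) → RightOfStairs (move p d)
  RightOfStairs-move {x , y} E right _ j j≤y = m<n⇒m<1+n (right j j≤y)
  RightOfStairs-move {x , y} N right ¬onA j j≤1+y with suc j * t ≤? y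
  ... | yes j≤y = right j j≤y
  ... | no  j≰y with suc j * s <? x
  ...   | yes below = below
  ...   | no  ¬below = contradiction (j , inj₁ (left-end j corner , ≮⇒≥ ¬below , sym corner)) ¬onA
    where
    corner : suc j * t ≡ suc y
    corner = ≤-antisym j≤1+y (≰⇒> j≰y)
    left-end : ∀ i → suc i * t ≡ suc y → i * s ≤ x
    left-end zero    _   = z≤n
    left-end (suc i) i≡y = <⇒≤ (right i (≤-pred (subst (suc i * t <_) i≡y (*-monoˡ-< t (n<1+n (suc i))))))

  avoids⇒RightOfStairs : ∀ {p} ds → RightOfStairs p →
    All (λ r → ¬ OnA s t r) (points p ds) → All RightOfStairs (visited p ds)
  avoids⇒RightOfStairs []           _     _             = []
  avoids⇒RightOfStairs {p} (d ∷ ds) right (_ ∷ avoids) with subst (All _) (points≡∷visited (move p d) ds) avoids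
  ... | ¬onA ∷ _ = right′ ∷ avoids⇒RightOfStairs ds right′ avoids
    where
    right′ : RightOfStairs (move p d)
    right′ = RightOfStairs-move d right ¬onA

  RightOfStairs⇒avoids : ∀ {p} ds → RightOfStairs p →
    All RightOfStairs (visited p ds) → All (λ r → ¬ OnA s t r) (points p ds)
  RightOfStairs⇒avoids {p} ds right rights =
    subst (All _) (sym (points≡∷visited p ds)) (All.map RightOfStairs⇒¬OnA (right ∷ rights))

  RightOfStairs-below : ∀ {k x₀ x y} → RightOfStairs (x₀ , k * t) → x₀ ≤ x → y < suc k * t → RightOfStairs (x , y)
  RightOfStairs-below {k} right x₀≤x y<top j j≤y =
    <-≤-trans (right j (*-monoˡ-≤ t (≤-pred (*-cancelʳ-< t (suc j) (suc k) (≤-<-trans j≤y y<top))))) x₀≤x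

  RightOfStairs-top : ∀ {k x} → RightOfStairs (x , suc k * t) ⇔ suc k * s < x
  RightOfStairs-top {k} = mk⇔ (λ right → right k ≤-refl)
    (λ k<x j j≤k → ≤-<-trans (*-monoˡ-≤ s (*-cancelʳ-≤ (suc j) (suc k) t j≤k)) k<x)

  visited-below : ∀ {k x₀} w x y → RightOfStairs (x₀ , k * t) → x₀ ≤ x → y + #N w < suc k * t →
    All RightOfStairs (visited (x , y) w)
  visited-below     []      x y right x₀≤x below = []
  visited-below {k} (E ∷ w) x y right x₀≤x below =
    RightOfStairs-below {k} right (m≤n⇒m≤1+n x₀≤x) (≤-<-trans (m≤m+n y (#N w)) below)
      ∷ visited-below {k} w (suc x) y right (m≤n⇒m≤1+n x₀≤x) below
  visited-below {k} (N ∷ w) x y right x₀≤x below =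
    RightOfStairs-below {k} right x₀≤x (≤-<-trans (s≤s (m≤m+n y (#N w))) below′)
      ∷ visited-below {k} w x (suc y) right x₀≤x below′
    where
    below′ : suc y + #N w < suc k * t
    below′ = subst (_< suc k * t) (+-suc y (#N w)) below

  block-height : ∀ k u → suc (#N u) ≡ t → k * t + #N (u ∷ʳ N) ≡ suc k * t
  block-height k u #N≡ = trans (cong (_+_ (k * t)) (trans (#N-∷ʳN u) #N≡)) (+-comm (k * t) t)

  block-visited : ∀ {k x} u → RightOfStairs (x , k * t) → suc (#N u) ≡ t →
    All RightOfStairs (visited (x , k * t) (u ∷ʳ N)) ⇔ suc k * s < x + #E (u ∷ʳ N)
  block-visited {k} {x} u right #N≡
    rewrite visited-++ (x , k * t) u (N ∷ []) | endpoint-counts x (k * t) u | #E-∷ʳN u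
    = mk⇔ (λ rights → Equivalence.to (RightOfStairs-top {k})
                        (subst (λ y → RightOfStairs (x + #E u , y)) top (All.head (All.++⁻ʳ _ rights))))
          (λ corner → All.++⁺ (visited-below {k} u x (k * t) right ≤-refl interior)
                        (subst (λ y → RightOfStairs (x + #E u , y)) (sym top)
                               (Equivalence.from (RightOfStairs-top {k}) corner) ∷ []))
    where
    top : suc (k * t + #N u) ≡ suc k * t
    top = trans (sym (+-suc (k * t) (#N u))) (trans (cong (_+_ (k * t)) #N≡) (+-comm (k * t) t))
    interior : k * t + #N u < suc k * t
    interior = subst (k * t + #N u <_) top ≤-refl

  blocks-visited : ∀ {k x} bs → RightOfStairs (x , k * t) → All (IsBlock t) bs →
    All RightOfStairs (visited (x , k * t) (concat bs)) ⇔ ClearsCorners s x k (map #E bs)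
  blocks-visited [] _ [] = mk⇔ (λ _ → tt) (λ _ → [])
  blocks-visited {k} {x} (_ ∷ bs) right ((u , #N≡ , refl) ∷ blocks′)
    rewrite visited-++ (x , k * t) (u ∷ʳ N) (concat bs) | endpoint-counts x (k * t) (u ∷ʳ N) | block-height k u #N≡
    = All-++-⇔ (visited (x , k * t) (u ∷ʳ N)) (block-visited {k} u right #N≡)
        (λ corner → blocks-visited bs (Equivalence.from (RightOfStairs-top {k}) corner) blocks′)

  blocks-visited-open : ∀ {k x} bs v → RightOfStairs (x , k * t) → All (IsBlock t) bs → suc (#N v) ≡ t →
    All RightOfStairs (visited (x , k * t) (concat bs ++ v)) ⇔ ClearsCorners s x k (map #E bs)
  blocks-visited-open {k} {x} [] v right [] #N≡ =
    mk⇔ (λ _ → tt) (λ _ → visited-below {k} v x (k * t) right ≤-refl below)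
    where
    below : k * t + #N v < suc k * t
    below = subst (k * t + #N v <_) (+-comm (k * t) t) (+-monoʳ-< (k * t) (subst (#N v <_) #N≡ ≤-refl))
  blocks-visited-open {k} {x} (_ ∷ bs) v right ((u , #N≡ , refl) ∷ blocks′) #N≡v
    rewrite ++-assoc (u ∷ʳ N) (concat bs) v
          | visited-++ (x , k * t) (u ∷ʳ N) (concat bs ++ v) | endpoint-counts x (k * t) (u ∷ʳ N) | block-height k u #N≡
    = All-++-⇔ (visited (x , k * t) (u ∷ʳ N)) (block-visited {k} u right #N≡)
        (λ corner → blocks-visited-open bs v (Equivalence.from (RightOfStairs-top {k}) corner) blocks′ #N≡v)

  blocks-visited-init : ∀ {k x u} bs → RightOfStairs (x , k * t) → All (IsBlock t) bs → 0 < length bs →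
    concat bs ≡ u ∷ʳ N → All RightOfStairs (visited (x , k * t) u) ⇔ ClearsCorners s x k (dropLast (map #E bs))
  blocks-visited-init {k} {x} {u} bs right blocks′ 0<n concat≡ with initLast bs
  blocks-visited-init {k} {x} {u} bs right blocks′ () concat≡ | []
  ... | bs′ ∷ʳ′ b with All.∷ʳ⁻ blocks′
  ...   | blocks″ , (v , #N≡ , refl)
    rewrite map-++ #E bs′ ((v ∷ʳ N) ∷ []) | dropLast-∷ʳ (map #E bs′) (#E (v ∷ʳ N))
          | ∷ʳ-injectiveˡ u (concat bs′ ++ v)
              (trans (sym concat≡) (trans (concat-∷ʳ bs′ (v ∷ʳ N)) (sym (++-assoc (concat bs′) v (N ∷ [])))))
    = blocks-visited-open {k} bs′ v right blocks″ #N≡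

-- Enumerating the two families of paths

module Enumeration (s′ t′ n′ : ℕ) where

  s t n B : ℕ
  s = suc s′
  t = suc t′
  n = suc n′
  B = t * n ∸ 1

  -- A word with t n − 1 north steps, closed by one more, splits into n blocks of t north steps.
  toBlocks : List Step → List (List Step)
  toBlocks u = blocks t′ n (u ∷ʳ N)

  fromBlocks : List (List Step) → List Step
  fromBlocks bs = dropLast (concat bs)

  profile : List Step → List ℕ
  profile u = map #E (toBlocks u)

  ρ : ℕ → List Step → List Step
  ρ j u = fromBlocks (rotate j (toBlocks u))

  toBlocks-spec : ∀ u → #N u ≡ B → All (IsBlock t) (toBlocks u) × concat (toBlocks u) ≡ u ∷ʳ N
  toBlocks-spec u #N≡ = blocks-∷ʳ t′ n′ u (trans (cong suc #N≡) (*-comm t n))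

  fromBlocks-toBlocks : ∀ u → #N u ≡ B → fromBlocks (toBlocks u) ≡ u
  fromBlocks-toBlocks u #N≡ = trans (cong dropLast (proj₂ (toBlocks-spec u #N≡))) (dropLast-∷ʳ u N)

  closed : ∀ {bs} → All (IsBlock t) bs → length bs ≡ n → concat bs ≡ fromBlocks bs ∷ʳ N
  closed {_ ∷ _} bs-blocks _ with concat-blocks-∷ʳN bs-blocks
  ... | v , concat≡ = trans concat≡ (cong (_∷ʳ N) (sym (trans (cong dropLast concat≡) (dropLast-∷ʳ v N))))

  module _ {bs} (bs-blocks : All (IsBlock t) bs) (length≡ : length bs ≡ n) where

    private
      concat≡ : concat bs ≡ fromBlocks bs ∷ʳ N
      concat≡ = closed bs-blocks length≡

    toBlocks-fromBlocks : toBlocks (fromBlocks bs) ≡ bs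
    toBlocks-fromBlocks = begin
      blocks t′ n (fromBlocks bs ∷ʳ N)    ≡⟨ cong (blocks t′ n) concat≡ ⟨
      blocks t′ n (concat bs)             ≡⟨ cong (λ k → blocks t′ k (concat bs)) length≡ ⟨
      blocks t′ (length bs) (concat bs)   ≡⟨ blocks-concat t′ bs-blocks ⟩
      bs                                  ∎

    #E-fromBlocks : #E (fromBlocks bs) ≡ sum (map #E bs)
    #E-fromBlocks = trans (sym (#E-∷ʳN (fromBlocks bs))) (trans (cong #E (sym concat≡)) (#E-concat bs))

    #N-fromBlocks : #N (fromBlocks bs) ≡ B
    #N-fromBlocks = suc-injective (begin
      suc (#N (fromBlocks bs))      ≡⟨ #N-∷ʳN (fromBlocks bs) ⟨
      #N (fromBlocks bs ∷ʳ N)       ≡⟨ cong #N concat≡ ⟨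
      #N (concat bs)                ≡⟨ #N-concat-blocks bs-blocks ⟩
      length bs * t                 ≡⟨ cong (_* t) length≡ ⟩
      n * t                         ≡⟨ *-comm n t ⟩
      t * n                         ∎)

  module _ (a : ℕ) {u} (u∈ : u ∈ words a B) where

    private
      counts = ∈-words⁻ a B u∈
      spec = toBlocks-spec u (proj₂ counts)
      rotated-blocks : ∀ j → All (IsBlock t) (rotate j (toBlocks u))
      rotated-blocks j = All-rotate j (proj₁ spec)
      rotated-length : ∀ j → length (rotate j (toBlocks u)) ≡ n
      rotated-length j = trans (length-rotate j (toBlocks u)) (length-blocks t′ n (u ∷ʳ N))

    length-profile : length (profile u) ≡ n
    length-profile = trans (length-map #E (toBlocks u)) (length-blocks t′ n (u ∷ʳ N))

    sum-profile : sum (profile u) ≡ a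
    sum-profile = begin
      sum (map #E (toBlocks u))   ≡⟨ #E-concat (toBlocks u) ⟨
      #E (concat (toBlocks u))    ≡⟨ cong #E (proj₂ spec) ⟩
      #E (u ∷ʳ N)                 ≡⟨ #E-∷ʳN u ⟩
      #E u                        ≡⟨ proj₁ counts ⟩
      a                           ∎

    profile-ρ : ∀ j → profile (ρ j u) ≡ rotate j (profile u)
    profile-ρ j = trans (cong (map #E) (toBlocks-fromBlocks (rotated-blocks j) (rotated-length j)))
                        (map-rotate #E j (toBlocks u))

    ρ-closed : ∀ j → ρ j u ∈ words a B
    ρ-closed j = Equivalence.from (∈-words a B)
      ( trans (#E-fromBlocks (rotated-blocks j) (rotated-length j))
              (trans (cong sum (map-rotate #E j (toBlocks u))) (trans (sum-rotate j (profile u)) sum-profile))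
      , #N-fromBlocks (rotated-blocks j) (rotated-length j))

    ρ-inverse : ∀ j → ρ (n ∸ j) (ρ j u) ≡ u
    ρ-inverse j = begin
      fromBlocks (rotate (n ∸ j) (toBlocks (fromBlocks (rotate j (toBlocks u)))))
        ≡⟨ cong (λ bs → fromBlocks (rotate (n ∸ j) bs)) (toBlocks-fromBlocks (rotated-blocks j) (rotated-length j)) ⟩
      fromBlocks (rotate (n ∸ j) (rotate j (toBlocks u)))
        ≡⟨ cong (λ k → fromBlocks (rotate (k ∸ j) (rotate j (toBlocks u)))) (length-blocks t′ n (u ∷ʳ N)) ⟨
      fromBlocks (rotate (length (toBlocks u) ∸ j) (rotate j (toBlocks u)))
        ≡⟨ cong fromBlocks (rotate-inverse j (toBlocks u)) ⟩
      fromBlocks (toBlocks u)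
        ≡⟨ fromBlocks-toBlocks u (proj₂ counts) ⟩
      u ∎

  count-words : ∀ a {Q : List ℕ → Set} (Q? : Decidable Q) →
    (∀ {es} → length es ≡ n → sum es ≡ a → ∃! _≡_ λ j → j < n × Q (rotate j es)) →
    n * length (filter (Q? ∘ profile) (words a B)) ≡ (a + B) C B
  count-words a {Q} Q? cycle =
    trans (orbit-count (Q? ∘ profile) n ρ (words-Unique a B) (λ {j} u∈ → ρ-closed a u∈ j) (λ {j} _ u∈ → ρ-inverse a u∈ j) unique-rotation)
          (length-words a B)
    where
    unique-rotation : ∀ {u} → u ∈ words a B → ∃! _≡_ λ j → j < n × Q (profile (ρ j u))
    unique-rotation u∈ with cycle (length-profile a u∈) (sum-profile a u∈)
    ... | j , (j<n , Qj) , unique =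
      j , (j<n , subst Q (sym (profile-ρ a u∈ j)) Qj) , λ {k} (k<n , Qk) → unique (k<n , subst Q (profile-ρ a u∈ k) Qk)

  start-right : ∀ x → RightOfStairs s t (x , 0)
  start-right x j ()

  corner-onA : ∀ k → OnA s t (suc k * s , suc k * t)
  corner-onA k = k , inj₂ (refl , ≤-refl , m≤n+m (suc k * t) t)

  -- Paths from (0,0): every block, including the last, must clear its corner.
  a₁ : ℕ
  a₁ = s * n + 1

  S₁ : List (List Step)
  S₁ = map (_∷ʳ N) (filter (clearsCorners? s 0 0 ∘ profile) (words a₁ B))

  visited-from-origin : ∀ {u} → #N u ≡ B →
    All (RightOfStairs s t) (visited (0 , 0) (u ∷ʳ N)) ⇔ ClearsCorners s 0 0 (profile u)
  visited-from-origin {u} #N≡ =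
    subst (λ w → All (RightOfStairs s t) (visited (0 , 0) w) ⇔ ClearsCorners s 0 0 (profile u))
          (proj₂ (toBlocks-spec u #N≡))
          (blocks-visited s t {0} (toBlocks u) (start-right 0) (proj₁ (toBlocks-spec u #N≡)))

  -- An east step into (s n + 1 , t n) would start at the corner (s n , t n) of the staircase.
  avoiding-ends-north : ∀ {ds} → AvoidingPath s t (0 , 0) (s * n + 1 , t * n) ds → ∃ λ u → ds ≡ u ∷ʳ N
  avoiding-ends-north {ds} (ends , avoids) with initLast ds
  ... | []      = contradiction (cong proj₁ ends) (λ ())
  ... | u ∷ʳ′ N = u , refl
  ... | u ∷ʳ′ E = contradiction corner (All-points-endpoint (0 , 0) u (E ∷ []) avoids)
    where
    corner : OnA s t (endpoint (0 , 0) u)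
    corner with endpoint (0 , 0) u | trans (sym (endpoint-++ (0 , 0) u (E ∷ []))) ends
    ... | x , y | last-step =
      subst (OnA s t) (cong₂ _,_ (trans (*-comm n s) (sym x≡)) (trans (*-comm n t) (sym (cong proj₂ last-step))))
            (corner-onA n′)
      where
      x≡ : x ≡ s * n
      x≡ = suc-injective (trans (cong proj₁ last-step) (+-comm (s * n) 1))

  S₁-Unique : Unique S₁
  S₁-Unique = Unique.map⁺ (∷ʳ-injectiveˡ _ _) (Unique.filter⁺ (clearsCorners? s 0 0 ∘ profile) (words-Unique a₁ B))

  S₁-members : ∀ ds → ds ∈ S₁ ⇔ AvoidingPath s t (0 , 0) (s * n + 1 , t * n) ds
  S₁-members ds = mk⇔ to from
    where
    to : ds ∈ S₁ → AvoidingPath s t (0 , 0) (s * n + 1 , t * n) ds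
    to ds∈ with ∈-map⁻ (_∷ʳ N) ds∈
    ... | u , u∈ , refl with ∈-filter⁻ (clearsCorners? s 0 0 ∘ profile) u∈
    ...   | u∈W , clears with ∈-words⁻ a₁ B u∈W
    ...     | #E≡ , #N≡ =
      trans (endpoint-counts 0 0 (u ∷ʳ N)) (cong₂ _,_ (trans (#E-∷ʳN u) #E≡) (trans (#N-∷ʳN u) (cong suc #N≡))) ,
      RightOfStairs⇒avoids s t (u ∷ʳ N) (start-right 0) (Equivalence.from (visited-from-origin #N≡) clears)
    from : AvoidingPath s t (0 , 0) (s * n + 1 , t * n) ds → ds ∈ S₁
    from path@(ends , avoids) with avoiding-ends-north path
    ... | u , refl = ∈-map⁺ (_∷ʳ N) (∈-filter⁺ (clearsCorners? s 0 0 ∘ profile) u∈W clears)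
      where
      counts : (#E (u ∷ʳ N) , #N (u ∷ʳ N)) ≡ (s * n + 1 , t * n)
      counts = trans (sym (endpoint-counts 0 0 (u ∷ʳ N))) ends
      #N≡ : #N u ≡ B
      #N≡ = suc-injective (trans (sym (#N-∷ʳN u)) (cong proj₂ counts))
      u∈W : u ∈ words a₁ B
      u∈W = Equivalence.from (∈-words a₁ B) (trans (sym (#E-∷ʳN u)) (cong proj₁ counts) , #N≡)
      clears : ClearsCorners s 0 0 (profile u)
      clears = Equivalence.to (visited-from-origin #N≡) (avoids⇒RightOfStairs s t (u ∷ʳ N) (start-right 0) avoids)

  -- Paths from (1,0): the path stops one step below the last corner, which therefore need not be cleared.
  a₂ : ℕ
  a₂ = s * n ∸ 1

  S₂ : List (List Step)
  S₂ = filter (clearsCorners? s 1 0 ∘ dropLast ∘ profile) (words a₂ B)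

  visited-from-start : ∀ {u} → #N u ≡ B →
    All (RightOfStairs s t) (visited (1 , 0) u) ⇔ ClearsCorners s 1 0 (dropLast (profile u))
  visited-from-start {u} #N≡ =
    blocks-visited-init s t {0} (toBlocks u) (start-right 1) (proj₁ (toBlocks-spec u #N≡))
      (subst (0 <_) (sym (length-blocks t′ n (u ∷ʳ N))) (s≤s z≤n)) (proj₂ (toBlocks-spec u #N≡))

  S₂-Unique : Unique S₂
  S₂-Unique = Unique.filter⁺ (clearsCorners? s 1 0 ∘ dropLast ∘ profile) (words-Unique a₂ B)

  S₂-members : ∀ ds → ds ∈ S₂ ⇔ AvoidingPath s t (1 , 0) (s * n , t * n ∸ 1) ds
  S₂-members ds = mk⇔ to from
    where
    to : ds ∈ S₂ → AvoidingPath s t (1 , 0) (s * n , t * n ∸ 1) ds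
    to ds∈ with ∈-filter⁻ (clearsCorners? s 1 0 ∘ dropLast ∘ profile) ds∈
    ... | ds∈W , clears with ∈-words⁻ a₂ B ds∈W
    ...   | #E≡ , #N≡ =
      trans (endpoint-counts 1 0 ds) (cong₂ _,_ (cong suc #E≡) #N≡) ,
      RightOfStairs⇒avoids s t ds (start-right 1) (Equivalence.from (visited-from-start #N≡) clears)
    from : AvoidingPath s t (1 , 0) (s * n , t * n ∸ 1) ds → ds ∈ S₂
    from (ends , avoids) = ∈-filter⁺ (clearsCorners? s 1 0 ∘ dropLast ∘ profile) ds∈W
      (Equivalence.to (visited-from-start #N≡) (avoids⇒RightOfStairs s t ds (start-right 1) avoids))
      where
      counts : (suc (#E ds) , #N ds) ≡ (s * n , t * n ∸ 1)
      counts = trans (sym (endpoint-counts 1 0 ds)) ends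
      #N≡ : #N ds ≡ B
      #N≡ = cong proj₂ counts
      ds∈W : ds ∈ words a₂ B
      ds∈W = Equivalence.from (∈-words a₂ B) (suc-injective (cong proj₁ counts) , #N≡)

  cycle₁ : ∀ {es} → length es ≡ n → sum es ≡ a₁ → ∃! _≡_ λ j → j < n × ClearsCorners s 0 0 (rotate j es)
  cycle₁ {es} len sum≡
    with cycleLemma-positive s es (subst (0 <_) (sym len) (s≤s z≤n))
                             (trans sum≡ (cong (_+ 1) (trans (*-comm s n) (cong (_* s) (sym len)))))
  ... | j , (j<n , positive) , unique =
    j , (subst (j <_) len j<n , Equivalence.from (clearsCorners⇔excessPositive s _) positive) ,
    λ (k<n , clears) → unique (subst (_ <_) (sym len) k<n , Equivalence.to (clearsCorners⇔excessPositive s _) clears)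

  cycle₂ : ∀ {es} → length es ≡ n → sum es ≡ a₂ → ∃! _≡_ λ j → j < n × ClearsCorners s 1 0 (dropLast (rotate j es))
  cycle₂ {es} len sum≡
    with cycleLemma-nonNegative s es (subst (0 <_) (sym len) (s≤s z≤n))
                                (trans (cong (_+ 1) sum≡) (trans (+-comm a₂ 1) (trans (*-comm s n) (cong (_* s) (sym len)))))
  ... | j , (j<n , nonNegative) , unique =
    j , (subst (j <_) len j<n , Equivalence.from (clearsCorners⇔excessNonNegative s _) nonNegative) ,
    λ (k<n , clears) → unique (subst (_ <_) (sym len) k<n , Equivalence.to (clearsCorners⇔excessNonNegative s _) clears)

  S₁-length : + length S₁ ≡ + t *ℤ binom (s * n + t * n) (+ (t * n))
                          - + s *ℤ binom (s * n + t * n) (+ (t * n) - + 1)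
  S₁-length = count⇒difference n t s {C = (s * n + t * n) C B}
    (trans (cong (n *_) (length-map (_∷ʳ N) (filter (clearsCorners? s 0 0 ∘ profile) (words a₁ B))))
           (trans (count-words a₁ (clearsCorners? s 0 0) cycle₁) (cong (_C B) (+-assoc (s * n) 1 B))))
    (absorption (s * n) B)

  S₂-length : + length S₂ ≡ + t *ℤ binom (s * n + t * n ∸ 2) (+ (t * n) - + 1)
                          - + s *ℤ binom (s * n + t * n ∸ 2) (+ (t * n) - + 2)
  S₂-length with binom-below a₂ B
  ... | Y , binom≡ , absorbed = begin
    + length S₂
      ≡⟨ count⇒difference n t s (count-words a₂ (clearsCorners? s 1 0 ∘ dropLast) cycle₂) (cong (_+_ X) absorbed) ⟩
    + t *ℤ + X - + s *ℤ + Y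
      ≡⟨ cong₂ (λ u v → + t *ℤ u - + s *ℤ v)
               (cong (λ m → binom m (+ B)) (sym N₂≡))
               (trans (sym binom≡) (cong (λ m → binom m (+ suc B - + 2)) (sym N₂≡))) ⟩
    + t *ℤ binom (s * n + t * n ∸ 2) (+ (t * n) - + 1)
      - + s *ℤ binom (s * n + t * n ∸ 2) (+ (t * n) - + 2) ∎
    where
    X = (a₂ + B) C B
    N₂≡ : s * n + t * n ∸ 2 ≡ a₂ + B
    N₂≡ = cong (_∸ 1) (+-suc a₂ B)

corollary1 : (s t n : ℕ) → 1 ≤ s → 1 ≤ t → 1 ≤ n →
    (∃ λ (S₁ : List (List Step)) → Unique S₁
        × (∀ ds → (ds ∈ S₁) ⇔ AvoidingPath s t (0 , 0) (s * n + 1 , t * n) ds)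
        × + length S₁ ≡ (+ t) *ℤ binom (s * n + t * n) (+ (t * n))
                        - (+ s) *ℤ binom (s * n + t * n) (+ (t * n) - + 1))
    × (∃ λ (S₂ : List (List Step)) → Unique S₂
        × (∀ ds → (ds ∈ S₂) ⇔ AvoidingPath s t (1 , 0) (s * n , t * n ∸ 1) ds)
        × + length S₂ ≡ (+ t) *ℤ binom (s * n + t * n ∸ 2) (+ (t * n) - + 1)
                        - (+ s) *ℤ binom (s * n + t * n ∸ 2) (+ (t * n) - + 2))
corollary1 (suc s′) (suc t′) (suc n′) _ _ _ =
  (S₁ , S₁-Unique , S₁-members , S₁-length) , (S₂ , S₂-Unique , S₂-members , S₂-length)
  where open Enumeration s′ t′ n′
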